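{- If an HDA $Q$ is not ordered, then it is not sculptable, i.e. there is no $d$ and no HDA embedding $Q\hookrightarrow B^d$.
   Context: Precubical sets: families of disjoint sets $Q_n$ with face maps $s_k,t_k:Q_n\to Q_{n-1}$ ($k=1,\dots,n$) satisfying $\alpha_k\beta_\ell=\beta_{\ell-1}\alpha_k$ for $\alpha,\beta\in\{s,t\}$, $k<\ell$. An HDA is a finite precubical set with initial cell $I\in Q_0$; HDA morphisms commute with face maps and preserve the initial cell; embeddings are injective HDA morphisms. The bulk $B^d$ has $n$-cells the tuples in $\{0,\ast,1\}^d$ with exactly $n$ entries $\ast$; $s_k$ (resp. $t_k$) replaces the $k$-th $\ast$ by $0$ (resp. $1$); initial cell $(0,\dots,0)$. Universal labels: $\approx$ is the equivalence on $Q_1$ generated by $(s_iq,t_iq)$ for $q\in Q_2$, $i\in\{1,2\}$; $\mathcal U(Q)=Q_1/\approx$, $\lambda(e)$ the class of $e$. $\lessdot$ is the transitive closure on $\mathcal U(Q)$ of $\{(\lambda(s_2q),\lambda(s_1q)):q\in Q_2\}$. $Q$ is ordered if there are no $a,b\in\mathcal U(Q)$ with both $a\lessdot b$ and $b\lessdot a$. -}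

module Defs where

open import Data.Nat using (ℕ; zero; suc; _<_)
open import Data.Fin using (Fin; zero; suc; inject₁; toℕ)
open import Data.Fin.Base using (_≤_)
open import Data.Bool using (Bool; true; false)
open import Data.Product using (Σ; ∃; ∃-syntax; _×_; _,_)
open import Relation.Nullary using (¬_)
open import Relation.Binary.PropositionalEquality using (_≡_)
open import Function.Bundles using (_↔_)
open import Function.Definitions using (Injective)
open import Relation.Binary.Construct.Closure.Equivalence using (EqClosure)
open import Relation.Binary.Construct.Closure.Transitive using (TransClosure)

-- Conventions: face maps are indexed by a Bool, false = s (source), true = t (target),
-- and the index k of s_k / t_k is 0-based: face α n k : Q_{n+1} → Q_n with k : Fin (n+1)
-- stands for α_{k+1}.

record PreHDA : Set₁ where
  field
    Cell : ℕ → Set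
    face : Bool → (n : ℕ) → Fin (suc n) → Cell (suc n) → Cell n
    init : Cell 0

open PreHDA public

-- Precubical identities  α_k β_ℓ = β_{ℓ-1} α_k  for k < ℓ (1-based).
-- With 0-based k' = k-1 (k' : Fin (n+1)) and ℓ = ℓ'+2 (ℓ' : Fin (n+1)), k < ℓ iff k' ≤ ℓ'.
IsPrecubical : PreHDA → Set
IsPrecubical Q = ∀ (α β : Bool) (n : ℕ) (k ℓ : Fin (suc n)) → k ≤ ℓ →
  (x : Cell Q (suc (suc n))) →
  face Q α n k (face Q β (suc n) (suc ℓ) x) ≡ face Q β n ℓ (face Q α (suc n) (inject₁ k) x)

IsFinite : PreHDA → Set
IsFinite Q = (∀ n → ∃[ m ] (Cell Q n ↔ Fin m)) × (∃[ D ] (∀ n → D < n → ¬ Cell Q n))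

record IsHDA (Q : PreHDA) : Set where
  field
    precubical : IsPrecubical Q
    finite     : IsFinite Q

record Morphism (Q P : PreHDA) : Set where
  field
    map      : ∀ n → Cell Q n → Cell P n
    map-face : ∀ α n k (x : Cell Q (suc n)) →
               map n (face Q α n k x) ≡ face P α n k (map (suc n) x)
    map-init : map 0 (init Q) ≡ init P

record Embedding (Q P : PreHDA) : Set where
  field
    morphism  : Morphism Q P
    injective : ∀ n → Injective _≡_ _≡_ (Morphism.map morphism n)

-- The bulk B^d.  BCell d n = tuples in {0,*,1}^d with exactly n entries *.
data BCell : ℕ → ℕ → Set where
  []  : BCell 0 0
  0∷_ : ∀ {d n} → BCell d n → BCell (suc d) n
  1∷_ : ∀ {d n} → BCell d n → BCell (suc d) n
  ∗∷_ : ∀ {d n} → BCell d n → BCell (suc d) (suc n)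

-- replace the k-th * (0-based) by 0 (α = false) or 1 (α = true)
bface : ∀ {d} → Bool → (n : ℕ) → Fin (suc n) → BCell d (suc n) → BCell d n
bface α n k (0∷ x) = 0∷ bface α n k x
bface α n k (1∷ x) = 1∷ bface α n k x
bface false n zero (∗∷ x) = 0∷ x
bface true n zero (∗∷ x) = 1∷ x
bface α (suc n) (suc k) (∗∷ x) = ∗∷ bface α n k x

bzero : (d : ℕ) → BCell d 0
bzero zero = []
bzero (suc d) = 0∷ bzero d

Bulk : ℕ → PreHDA
Bulk d = record { Cell = BCell d ; face = bface ; init = bzero d }

LabelGen : (Q : PreHDA) → Cell Q 1 → Cell Q 1 → Set
LabelGen Q e f = ∃[ q ] ∃[ i ] (face Q false 1 i q ≡ e × face Q true 1 i q ≡ f)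

LabelEq : (Q : PreHDA) → Cell Q 1 → Cell Q 1 → Set
LabelEq Q e f = EqClosure (LabelGen Q) e f

-- generating relation of ⋖ lifted to representatives:
-- λ(e) related to λ(f) iff there is q ∈ Q_2 with e ≈ s_2 q and f ≈ s_1 q.
LessGen : (Q : PreHDA) → Cell Q 1 → Cell Q 1 → Set
LessGen Q e f = ∃[ q ] (LabelEq Q e (face Q false 1 (suc zero) q) × LabelEq Q f (face Q false 1 zero q))

LabelLess : (Q : PreHDA) → Cell Q 1 → Cell Q 1 → Set
LabelLess Q e f = TransClosure (LessGen Q) e f

Ordered : PreHDA → Set
Ordered Q = ¬ (∃[ a ] ∃[ b ] (LabelLess Q a b × LabelLess Q b a))

Sculptable : PreHDA → Set
Sculptable Q = ∃[ d ] Embedding Q (Bulk d)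

module Submission where

-- A 1-cell of the bulk B^d is a word in {0,*,1}^d with a single *;
-- its "star position" (the index of that *) is a natural number.  Pulling the
-- star position back along a morphism Q → B^d gives a potential on the 1-cells
-- of Q which
--   * is invariant under the generators of ≈: s_i q and t_i q keep the same
--     remaining * of the 2-cell q (only the other * is filled in), and
--   * strictly increases along the generators of ⋖: in a 2-cell q of B^d, s_2 q
--     keeps the first * and s_1 q keeps the second one.
-- Any HDA carrying such an ℕ-valued potential is ordered, since a cycle
-- a ⋖ b ⋖ a would give a strictly decreasing pair of naturals.  Hence every
-- HDA admitting a morphism (in particular an embedding) into some B^d is
-- ordered, which is the contrapositive of the proposition.

open import Defs
open import Relation.Nullary using (¬_)
open import Data.Nat using (ℕ; zero; suc; _<_; s≤s; z≤n)
open import Data.Nat.Properties using (<-trans; <-asym)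
open import Data.Fin using (Fin; zero; suc)
open import Data.Bool using (true; false)
open import Data.Product using (_,_)
open import Relation.Binary.PropositionalEquality
  using (_≡_; refl; sym; trans; cong; isEquivalence; module ≡-Reasoning)
open import Relation.Binary.Construct.Closure.Equivalence using (gfold)
open import Relation.Binary.Construct.Closure.Transitive using ([_]; _∷_)

record Potential (Q : PreHDA) : Set where
  field
    value      : Cell Q 1 → ℕ
    invariant  : ∀ {e f} → LabelGen Q e f → value e ≡ value f
    increasing : ∀ q → value (face Q false 1 (suc zero) q) < value (face Q false 1 zero q)

module _ {Q : PreHDA} (φ : Potential Q) where
  open Potential φ

  potential-respects-labels : ∀ {e f} → LabelEq Q e f → value e ≡ value f
  potential-respects-labels = gfold isEquivalence value invariant

  potential-increases-gen : ∀ {e f} → LessGen Q e f → value e < value f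
  potential-increases-gen (q , e≈s₂q , f≈s₁q) rewrite
      potential-respects-labels e≈s₂q | potential-respects-labels f≈s₁q =
    increasing q

  potential-increases : ∀ {e f} → LabelLess Q e f → value e < value f
  potential-increases [ e⋖f ]      = potential-increases-gen e⋖f
  potential-increases (e⋖g ∷ g⋖f) =
    <-trans (potential-increases-gen e⋖g) (potential-increases g⋖f)

  potential⇒ordered : Ordered Q
  potential⇒ordered (a , b , a⋖b , b⋖a) =
    <-asym (potential-increases a⋖b) (potential-increases b⋖a)

starPosition : ∀ {d} → BCell d 1 → ℕ
starPosition (0∷ x) = suc (starPosition x)
starPosition (1∷ x) = suc (starPosition x)
starPosition (∗∷ x) = 0

-- Filling the i-th * of a 2-cell by 1 instead of 0 leaves the other * in place.
starPosition-target≡source : ∀ {d} (i : Fin 2) (q : BCell d 2) →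
  starPosition (bface true 1 i q) ≡ starPosition (bface false 1 i q)
starPosition-target≡source i          (0∷ q) = cong suc (starPosition-target≡source i q)
starPosition-target≡source i          (1∷ q) = cong suc (starPosition-target≡source i q)
starPosition-target≡source zero       (∗∷ q) = refl
starPosition-target≡source (suc zero) (∗∷ q) = refl

-- s_2 q keeps the first * of q and s_1 q keeps the second one.
starPosition-s₂<s₁ : ∀ {d} (q : BCell d 2) →
  starPosition (bface false 1 (suc zero) q) < starPosition (bface false 1 zero q)
starPosition-s₂<s₁ (0∷ q) = s≤s (starPosition-s₂<s₁ q)
starPosition-s₂<s₁ (1∷ q) = s≤s (starPosition-s₂<s₁ q)
starPosition-s₂<s₁ (∗∷ q) = s≤s z≤n

bulkPotential : ∀ {Q d} → Morphism Q (Bulk d) → Potential Q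
bulkPotential {Q} {d} m = record
  { value      = value
  ; invariant  = invariant
  ; increasing = increasing
  }
  where
  open Morphism m

  value : Cell Q 1 → ℕ
  value e = starPosition (map 1 e)

  value-face : ∀ α i q → value (face Q α 1 i q) ≡ starPosition (bface α 1 i (map 2 q))
  value-face α i q = cong starPosition (map-face α 1 i q)

  invariant : ∀ {e f} → LabelGen Q e f → value e ≡ value f
  invariant (q , i , refl , refl) = begin
    value (face Q false 1 i q)                  ≡⟨ value-face false i q ⟩
    starPosition (bface false 1 i (map 2 q))    ≡⟨ sym (starPosition-target≡source i (map 2 q)) ⟩
    starPosition (bface true 1 i (map 2 q))     ≡⟨ sym (value-face true i q) ⟩
    value (face Q true 1 i q)                   ∎
    where open ≡-Reasoning

  increasing : ∀ q → value (face Q false 1 (suc zero) q) < value (face Q false 1 zero q)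
  increasing q rewrite value-face false (suc zero) q | value-face false zero q =
    starPosition-s₂<s₁ (map 2 q)

bulk-morphism⇒ordered : ∀ {Q d} → Morphism Q (Bulk d) → Ordered Q
bulk-morphism⇒ordered m = potential⇒ordered (bulkPotential m)

proposition3p5 : (Q : PreHDA) → IsHDA Q → ¬ Ordered Q → ¬ Sculptable Q
proposition3p5 Q _ notOrdered (d , embedding) =
  notOrdered (bulk-morphism⇒ordered (Embedding.morphism embedding))
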